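{- Let $G=(V,A,s)$ be a flow graph with $n$ vertices, let $T$ be a spanning tree of $G$ rooted at $s$ with parent function $p$, and let the vertices be numbered $1,\dots,n$ in a bottom-up order of $T$ and identified with their numbers. Let $u$ and $v$ be distinct vertices such that $v\in\mathit{loop}(u)$ and $d(x)>u$ for every descendant $x\neq s$ of $u$ in $T$. Let $G'$ (and the spanning tree $T'$) be obtained from $G$ (and $T$) by performing $\mathit{transform}(u,v)$. Then the dominator tree $D'$ of $G'$ is the dominator tree $D$ of $G$ with $v$ and its incoming arc $(d(v),v)$ deleted.
   Context: A flow graph $G=(V,A,s)$ is a finite directed graph (parallel arcs and loop arcs allowed) with start vertex $s$ from which every vertex is reachable. A vertex $x$ dominates $y$ if every path from $s$ to $y$ contains $x$; every $y\neq s$ has a unique immediate dominator $d(y)\ne y$, a dominator of $y$ such that every dominator of $y$ other than $y$ dominates $d(y)$; the dominator tree $D$ is the tree rooted at $s$ with parent function $d$. A bottom-up order numbers the vertices with distinct integers $1,\dots,n$ so that $x<p(x)$ for all $x\ne s$. For a vertex $u$, $\mathit{loop}(u)$ is the set of descendants $x$ of $u$ in $T$ such that there is a path in $G$ from $x$ to $u$ containing only descendants of $u$ in $T$. Contracting a vertex $v$ into $x\ne v$ replaces every arc end equal to $v$ by $x$ and deletes $v$; contracting $v$ into $p(v)$ turns $T$ into the spanning tree $T'$ whose parent function is $p'(w)=p(w)$ if $p(w)\ne v$ and $p'(w)=p(v)$ if $p(w)=v$. For $u$ a proper ancestor of $v$ in $T$ (with $u\ne s$), $\mathit{transform}(u,v)$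 consists of: Step 0: for each arc from $v$ to a proper descendant $w\notin\{v,p(v)\}$ of $u$ in $T$, add an arc from $p(u)$ to $w$; Step 1: contract $v$ into $p(v)$. -}

module Defs where

open import Data.Nat using (ℕ; _<_)
open import Data.Fin using (Fin; toℕ; _≟_)
open import Data.Product using (Σ; _×_; _,_)
open import Data.Sum using (_⊎_)
open import Data.List using (List; []; _∷_)
open import Data.List.Membership.Propositional using (_∈_)
open import Data.List.Relation.Unary.All using (All)
open import Relation.Binary.PropositionalEquality using (_≡_; _≢_)
open import Relation.Nullary using (yes; no)

-- Vertices of a graph with n vertices are the elements of Fin n; the
-- number of vertex x (in the bottom-up order) is toℕ x + 1, so the
-- order on vertices is the order of toℕ.

ArcRel : ℕ → Set₁
ArcRel n = Fin n → Fin n → Set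

arcsOf : {n : ℕ} → List (Fin n × Fin n) → ArcRel n
arcsOf A x y = (x , y) ∈ A

data Path {n : ℕ} (R : ArcRel n) : Fin n → Fin n → Set where
  []  : ∀ {x} → Path R x x
  _∷_ : ∀ {x y z} → R x y → Path R y z → Path R x z

verts : {n : ℕ} {R : ArcRel n} {x y : Fin n} → Path R x y → List (Fin n)
verts {x = x} []      = x ∷ []
verts {x = x} (e ∷ q) = x ∷ verts q

Dominates : {n : ℕ} → ArcRel n → Fin n → Fin n → Fin n → Set
Dominates R s x y = (q : Path R s y) → x ∈ verts q

IsIdom : {n : ℕ} → ArcRel n → Fin n → Fin n → Fin n → Set
IsIdom R s x y =
  (x ≢ y) × Dominates R s x y
  × ((z : Fin _) → z ≢ y → Dominates R s z y → Dominates R s z x)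

data Desc {n : ℕ} (p : Fin n → Fin n) (s : Fin n) (u : Fin n) : Fin n → Set where
  here : Desc p s u u
  up   : ∀ {w} → w ≢ s → Desc p s u (p w) → Desc p s u w

ProperDesc : {n : ℕ} → (Fin n → Fin n) → Fin n → Fin n → Fin n → Set
ProperDesc p s u w = Desc p s u w × w ≢ u

InLoop : {n : ℕ} → ArcRel n → (Fin n → Fin n) → Fin n → Fin n → Fin n → Set
InLoop R p s u x =
  Desc p s u x × Σ (Path R x u) (λ q → All (Desc p s u) (verts q))

step0 : {n : ℕ} → ArcRel n → (Fin n → Fin n) → Fin n → Fin n → Fin n → ArcRel n
step0 R p s u v x y =
  R x y ⊎ (x ≡ p u × R v y × ProperDesc p s u y × y ≢ v × y ≢ p v)

rename : {n : ℕ} → Fin n → Fin n → Fin n → Fin n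
rename v t z with z ≟ v
... | yes _ = t
... | no _  = z

-- Contract v into t: every arc end equal to v is replaced by t
-- (v is thereby deleted: no arc is incident to it any more).
contract : {n : ℕ} → ArcRel n → Fin n → Fin n → ArcRel n
contract R v t x y =
  Σ (Fin _) λ a → Σ (Fin _) λ b → R a b × rename v t a ≡ x × rename v t b ≡ y

transformArcs : {n : ℕ} → ArcRel n → (Fin n → Fin n) → Fin n → Fin n → Fin n → ArcRel n
transformArcs R p s u v = contract (step0 R p s u v) v (p v)

-- The hypothesis on immediate dominators means that no proper dominator of a
-- vertex below u lies below u (a proper dominator of y is an ancestor of
-- d(y) > u); in particular v dominates no other vertex.  Each arc of G' is
-- realised in G by a path whose additional vertices lie below u (through the
-- tree arc into v, the loop from v back to p(v), or the tree path from p(u)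
-- down to v), so dominance in G carries over to G'.  Conversely, renaming v to
-- p(v) turns paths of G into paths of G', and a path of G avoiding p(v) gives
-- one of G' avoiding p(v).  So dominance among vertices other than v, and
-- with it the immediate dominators, is the same in G and G'.
module Submission where

open import Defs
open import Data.Nat using (ℕ; _<_; _≤_)
open import Data.Fin using (Fin; toℕ; _≟_; _>_)
open import Data.Fin.Properties using (≤-antisym)
open import Data.Nat.Properties using (≤-refl; ≤-trans; <⇒≤; <⇒≱)
open import Data.Product using (Σ; ∃; _×_; _,_; proj₁; proj₂)
open import Data.Sum using (_⊎_; inj₁; inj₂; map₁; [_,_]′)
open import Data.Empty using (⊥-elim)
open import Data.List using (List; []; _∷_; map)
open import Data.List.Membership.Propositional using (_∈_)
open import Data.List.Membership.Propositional.Properties using (∈-map⁻)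
open import Data.List.Relation.Unary.Any using (here; there)
open import Data.List.Relation.Unary.All as All using (All; []; _∷_; lookup; tabulate)
open import Data.List.Relation.Unary.All.Properties.Core using (¬Any⇒All¬)
open import Function using (_∘_; id)
open import Function.Bundles using (_⇔_; mk⇔; Equivalence)
open import Induction.WellFounded using (Acc; acc)
open import Data.Fin.Induction using (>-wellFounded)
open import Relation.Binary.PropositionalEquality using (_≡_; _≢_; refl; sym; trans; subst; subst₂; cong)
open import Relation.Nullary using (¬_; yes; no; Dec)
open import Relation.Nullary.Decidable using (map′; ¬¬-excluded-middle)

private
  variable
    n : ℕ
    R R' : ArcRel n
    c s t v w x x' y y' z : Fin n

module _ {R : ArcRel n} where

  infixr 5 _++ₚ_
  _++ₚ_ : Path R x y → Path R y z → Path R x z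
  []      ++ₚ r = r
  (e ∷ q) ++ₚ r = e ∷ (q ++ₚ r)

  first∈ : (q : Path R x y) → x ∈ verts q
  first∈ []      = here refl
  first∈ (_ ∷ _) = here refl

  last∈ : (q : Path R x y) → y ∈ verts q
  last∈ []      = here refl
  last∈ (_ ∷ q) = there (last∈ q)

  All-++ₚ : {P : Fin n → Set} {q : Path R x y} {r : Path R y z} →
            All P (verts q) → All P (verts r) → All P (verts (q ++ₚ r))
  All-++ₚ {q = []}    _          Pr = Pr
  All-++ₚ {q = _ ∷ _} (Px ∷ Pq) Pr = Px ∷ All-++ₚ Pq Pr

mapPath : (f : Fin n → Fin n) → (∀ {a b} → R a b → R' (f a) (f b)) →
          Path R x y → f x ≡ x' → f y ≡ y' → Path R' x' y'
mapPath f F []      refl refl = []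
mapPath f F (e ∷ q) refl fy   = F e ∷ mapPath f F q refl fy

verts-mapPath : (f : Fin n → Fin n) (F : ∀ {a b} → R a b → R' (f a) (f b))
                (q : Path R x y) (fx : f x ≡ x') (fy : f y ≡ y') →
                verts (mapPath {R' = R'} f F q fx fy) ≡ map f (verts q)
verts-mapPath f F []      refl refl = refl
verts-mapPath f F (e ∷ q) refl fy   = cong (f _ ∷_) (verts-mapPath f F q refl fy)

rename-≢ : z ≢ v → rename v t z ≡ z
rename-≢ {z = z} {v = v} z≢v with z ≟ v
... | yes z≡v = ⊥-elim (z≢v z≡v)
... | no _    = refl

isIdom-transfer : (∀ {a b} → b ≢ v → Dominates R s a b ⇔ Dominates R' s a b) →
                  (∀ {b} → b ≢ v → ¬ Dominates R s v b) →
                  w ≢ v → IsIdom R' s x w ⇔ IsIdom R s x w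
isIdom-transfer {v = v} {R = R} {s = s} {R' = R'} {w = w} {x = x} same v-dominates-nothing w≢v =
  mk⇔ idom'⇒idom idom⇒idom'
  where
  open Equivalence using (to; from)

  dominator-≢v : ∀ {a} → Dominates R s a w → a ≢ v
  dominator-≢v Da refl = v-dominates-nothing w≢v Da

  idom'⇒idom : IsIdom R' s x w → IsIdom R s x w
  idom'⇒idom (x≢w , Dx , dominated) =
    x≢w , from (same w≢v) Dx ,
    λ z z≢w Dz → from (same (dominator-≢v (from (same w≢v) Dx)))
                   (dominated z z≢w (to (same w≢v) Dz))

  idom⇒idom' : IsIdom R s x w → IsIdom R' s x w
  idom⇒idom' (x≢w , Dx , dominated) =
    x≢w , to (same w≢v) Dx ,
    λ z z≢w Dz → to (same (dominator-≢v Dx))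
                   (dominated z z≢w (from (same w≢v) Dz))

module BottomUpTree {n : ℕ} (s : Fin n) (p : Fin n → Fin n)
  (order : (x : Fin n) → x ≢ s → toℕ x < toℕ (p x)) where

  infix 4 _⊑_
  _⊑_ : Fin n → Fin n → Set
  x ⊑ y = Desc p s y x

  upward-induction : (P : Fin n → Set) → P s → (∀ x → x ≢ s → P (p x) → P x) → ∀ x → P x
  upward-induction P Ps step x = go x (>-wellFounded x)
    where
    go : ∀ x → Acc _>_ x → P x
    go x (acc rec) with x ≟ s
    ... | yes refl = Ps
    ... | no x≢s   = step x x≢s (go (p x) (rec (order x x≢s)))

  ⊑-toℕ : x ⊑ y → toℕ x ≤ toℕ y
  ⊑-toℕ here           = ≤-refl
  ⊑-toℕ (up x≢s px⊑y) = ≤-trans (<⇒≤ (order _ x≢s)) (⊑-toℕ px⊑y)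

  ⊑-antisym : x ⊑ y → y ⊑ x → x ≡ y
  ⊑-antisym x⊑y y⊑x = ≤-antisym (⊑-toℕ x⊑y) (⊑-toℕ y⊑x)

  ⊑-trans : x ⊑ y → y ⊑ z → x ⊑ z
  ⊑-trans here           y⊑z = y⊑z
  ⊑-trans (up x≢s px⊑y) y⊑z = up x≢s (⊑-trans px⊑y y⊑z)

  ⊑-parent : x ≢ s → x ⊑ p x
  ⊑-parent x≢s = up x≢s here

  parent-⋢ : x ≢ s → ¬ p x ⊑ x
  parent-⋢ x≢s px⊑x = <⇒≱ (order _ x≢s) (⊑-toℕ px⊑x)

  parent-≢ : x ≢ s → p x ≢ x
  parent-≢ {x = x} x≢s px≡x = parent-⋢ x≢s (subst (p x ⊑_) px≡x here)

  parent-⊑ : x ⊑ y → x ≢ y → p x ⊑ y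
  parent-⊑ here          x≢x = ⊥-elim (x≢x refl)
  parent-⊑ (up _ px⊑y) _   = px⊑y

  root-⊑ : s ⊑ y → y ≡ s
  root-⊑ here          = refl
  root-⊑ (up s≢s _) = ⊥-elim (s≢s refl)

  ⊑-root : ∀ x → x ⊑ s
  ⊑-root = upward-induction (_⊑ s) here (λ _ → up)

  ancestors-comparable : x ⊑ y → x ⊑ z → y ⊑ z ⊎ z ⊑ y
  ancestors-comparable here          x⊑z           = inj₁ x⊑z
  ancestors-comparable (up x≢s px⊑y) here          = inj₂ (up x≢s px⊑y)
  ancestors-comparable (up _ px⊑y)   (up _ px⊑z) = ancestors-comparable px⊑y px⊑z

  _⊑?_ : ∀ x y → Dec (x ⊑ y)
  x ⊑? y = upward-induction (λ x → Dec (x ⊑ y)) s⊑?y step x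
    where
    s⊑?y : Dec (s ⊑ y)
    s⊑?y with y ≟ s
    ... | yes refl = yes here
    ... | no y≢s   = no (y≢s ∘ root-⊑)

    step : ∀ x → x ≢ s → Dec (p x ⊑ y) → Dec (x ⊑ y)
    step x x≢s px⊑?y with x ≟ y
    ... | yes refl = yes here
    ... | no x≢y   = map′ (up x≢s) (λ x⊑y → parent-⊑ x⊑y x≢y) px⊑?y

module SpanningTree {n : ℕ} (A : List (Fin n × Fin n)) (s : Fin n) (p : Fin n → Fin n)
  (treeArc : (x : Fin n) → x ≢ s → (p x , x) ∈ A)
  (order : (x : Fin n) → x ≢ s → toℕ x < toℕ (p x)) where

  open BottomUpTree s p order public

  G : ArcRel n
  G = arcsOf A

  Dom : Fin n → Fin n → Set
  Dom = Dominates G s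

  treePath : y ⊑ x → Σ (Path G x y) λ q → All (λ z → y ⊑ z × z ⊑ x) (verts q)
  treePath here = [] , (here , here) ∷ []
  treePath {y = y} (up y≢s py⊑x) =
    q ++ₚ (treeArc y y≢s ∷ []) ,
    All-++ₚ (All.map (λ (py⊑z , z⊑x) → ⊑-trans (⊑-parent y≢s) py⊑z , z⊑x) q-between)
            ((⊑-parent y≢s , py⊑x) ∷ (here , up y≢s py⊑x) ∷ [])
    where
    q = proj₁ (treePath py⊑x)
    q-between = proj₂ (treePath py⊑x)

  dominator-is-ancestor : Dom x y → y ⊑ x
  dominator-is-ancestor {y = y} Dx =
    proj₁ (lookup (proj₂ (treePath (⊑-root y))) (Dx (proj₁ (treePath (⊑-root y)))))

  NoDominatorBetween : Fin n → Fin n → Set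
  NoDominatorBetween c y = ∀ z → y ⊑ z → z ⊑ c → z ≢ y → z ≢ c → ¬ Dom z y

  nearest-dominator-is-idom : y ⊑ c → c ≢ y → NoDominatorBetween c y → Dom c y → IsIdom G s c y
  nearest-dominator-is-idom {y = y} {c = c} y⊑c c≢y none Dc = c≢y , Dc , dominates-c
    where
    dominates-c : ∀ z → z ≢ y → Dom z y → Dom z c
    dominates-c z z≢y Dz with ancestors-comparable y⊑c (dominator-is-ancestor Dz)
    ... | inj₂ z⊑c with z ≟ c
    ...   | yes refl = last∈
    ...   | no z≢c   = ⊥-elim (none z (dominator-is-ancestor Dz) z⊑c z≢y z≢c Dz)
    dominates-c z z≢y Dz | inj₁ c⊑z = λ q →
      let (r , r-below-c) = treePath y⊑c in
      [ id , (λ z⊑c → subst (_∈ verts q) (⊑-antisym c⊑z z⊑c) (last∈ q)) ]′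
        (lookup (All-++ₚ (tabulate inj₁) (All.map (inj₂ ∘ proj₂) r-below-c)) (Dz (q ++ₚ r)))

  no-dominator-between-parent : y ≢ s → NoDominatorBetween (p y) y
  no-dominator-between-parent y≢s z y⊑z z⊑py z≢y z≢py _ =
    z≢py (⊑-antisym z⊑py (parent-⊑ y⊑z (z≢y ∘ sym)))

  no-dominator-between-step : y ⊑ c → ¬ Dom c y → NoDominatorBetween c y → NoDominatorBetween (p c) y
  no-dominator-between-step {c = c} y⊑c ¬Dc none z y⊑z z⊑pc z≢y z≢pc Dz with z ≟ c
  ... | yes refl = ¬Dc Dz
  ... | no z≢c with ancestors-comparable y⊑z y⊑c
  ...   | inj₁ z⊑c = none z y⊑z z⊑c z≢y z≢c Dz
  ...   | inj₂ c⊑z = z≢pc (⊑-antisym z⊑pc (parent-⊑ c⊑z (z≢c ∘ sym)))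

  idom-exists : y ≢ s → ¬ ¬ ∃ λ d → IsIdom G s d y
  idom-exists {y = y} y≢s =
    upward-induction P base step (p y) (⊑-parent y≢s) (parent-≢ y≢s) (no-dominator-between-parent y≢s)
    where
    P : Fin n → Set
    P c = y ⊑ c → c ≢ y → NoDominatorBetween c y → ¬ ¬ ∃ λ d → IsIdom G s d y

    base : P s
    base y⊑s s≢y none k = k (s , nearest-dominator-is-idom y⊑s s≢y none first∈)

    step : ∀ c → c ≢ s → P (p c) → P c
    step c c≢s ih y⊑c c≢y none k = ¬¬-excluded-middle λ
      { (yes Dc) → k (c , nearest-dominator-is-idom y⊑c c≢y none Dc)
      ; (no ¬Dc) → ih (⊑-trans y⊑c (⊑-parent c≢s)) pc≢y (no-dominator-between-step y⊑c ¬Dc none) k }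
      where
      pc≢y : p c ≢ y
      pc≢y refl = parent-⋢ c≢s y⊑c

  dominators-outside-subtree :
    ((x z : Fin n) → x ⊑ t → x ≢ s → IsIdom G s z x → toℕ t < toℕ z) →
    y ⊑ t → y ≢ s → Dom x y → x ≢ y → ¬ x ⊑ t
  dominators-outside-subtree {y = y} {x = x} idoms-above y⊑t y≢s Dx x≢y x⊑t =
    idom-exists y≢s λ (d , d-idom@(_ , _ , dominated)) →
      <⇒≱ (idoms-above y d y⊑t y≢s d-idom)
          (⊑-toℕ (⊑-trans (dominator-is-ancestor (dominated x x≢y Dx)) x⊑t))

module Transform {n : ℕ} (A : List (Fin n × Fin n)) (s : Fin n) (p : Fin n → Fin n)
  (treeArc : (x : Fin n) → x ≢ s → (p x , x) ∈ A)
  (order : (x : Fin n) → x ≢ s → toℕ x < toℕ (p x))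
  (u v : Fin n) (u≢v : u ≢ v)
  (v∈loop : InLoop (arcsOf A) p s u v)
  (dominators-outside : ∀ {x y} → Desc p s u y → y ≢ s → Dominates (arcsOf A) s x y → x ≢ y
                        → ¬ Desc p s u x) where

  open SpanningTree A s p treeArc order
  open import Data.List.Membership.DecPropositional (_≟_ {n}) using (_∈?_)

  G' : ArcRel n
  G' = transformArcs G p s u v

  Dom' : Fin n → Fin n → Set
  Dom' = Dominates G' s

  ren : Fin n → Fin n
  ren = rename v (p v)

  v⊑u : v ⊑ u
  v⊑u = proj₁ v∈loop

  v≢s : v ≢ s
  v≢s v≡s = u≢v (trans (root-⊑ (subst (_⊑ u) v≡s v⊑u)) (sym v≡s))

  s≢v : s ≢ v
  s≢v = v≢s ∘ sym

  below-u-≢s : y ⊑ u → y ≢ s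
  below-u-≢s y⊑u refl = dominators-outside v⊑u v≢s first∈ s≢v y⊑u

  u≢s : u ≢ s
  u≢s = below-u-≢s here

  pv⊑u : p v ⊑ u
  pv⊑u = parent-⊑ v⊑u (u≢v ∘ sym)

  pu≢v : p u ≢ v
  pu≢v pu≡v = parent-⋢ u≢s (subst (_⊑ u) (sym pu≡v) v⊑u)

  v-dominates-nothing : w ≢ v → ¬ Dom v w
  v-dominates-nothing w≢v Dv =
    dominators-outside w⊑u (below-u-≢s w⊑u) Dv (w≢v ∘ sym) v⊑u
    where
    w⊑u = ⊑-trans (dominator-is-ancestor Dv) v⊑u

  idom-≢v : IsIdom G s x w → x ≢ v
  idom-≢v (x≢w , Dx , _) refl = v-dominates-nothing (x≢w ∘ sym) Dx

  preserved-arc : G x y → x ≢ v → y ≢ v → G' x y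
  preserved-arc e x≢v y≢v = _ , _ , inj₁ e , rename-≢ x≢v , rename-≢ y≢v

  renamed-arc : G x y → G' (ren x) (ren y)
  renamed-arc e = _ , _ , inj₁ e , refl , refl

  project : Path G x y → x ≢ v → y ≢ v → Path G' x y
  project q x≢v y≢v = mapPath ren renamed-arc q (rename-≢ x≢v) (rename-≢ y≢v)

  ∈-project⁻ : (q : Path G x y) (x≢v : x ≢ v) (y≢v : y ≢ v) →
               z ∈ verts (project q x≢v y≢v) → ∃ λ w → w ∈ verts q × z ≡ ren w
  ∈-project⁻ q x≢v y≢v z∈ =
    ∈-map⁻ ren (subst (_ ∈_) (verts-mapPath ren renamed-arc q (rename-≢ x≢v) (rename-≢ y≢v)) z∈)

  renamed-to-pv : p v ≡ ren w → w ⊑ p v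
  renamed-to-pv {w = w} pv≡ren-w with w ≟ v
  ... | yes refl = ⊑-parent v≢s
  ... | no _     = subst (_⊑ p v) pv≡ren-w here

  PathAvoidingPv : Fin n → Set
  PathAvoidingPv y = Σ (Path G' s y) λ q → All (p v ≢_) (verts q)

  path-outside-pv : ¬ y ⊑ p v → PathAvoidingPv y
  path-outside-pv {y = y} y⋢pv = project q s≢v y≢v , tabulate avoids
    where
    q = proj₁ (treePath (⊑-root y))
    y≢v : y ≢ v
    y≢v refl = y⋢pv (⊑-parent v≢s)
    avoids : z ∈ verts (project q s≢v y≢v) → p v ≢ z
    avoids z∈ pv≡z with ∈-project⁻ q s≢v y≢v z∈
    ... | w , w∈q , z≡ren-w =
      y⋢pv (⊑-trans (proj₁ (lookup (proj₂ (treePath (⊑-root y))) w∈q))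
                    (renamed-to-pv (trans pv≡z z≡ren-w)))

  extend-avoiding : PathAvoidingPv x → G' x y → p v ≢ y → PathAvoidingPv y
  extend-avoiding (q , avoids) e pv≢y =
    q ++ₚ (e ∷ []) , All-++ₚ avoids (lookup avoids (last∈ q) ∷ pv≢y ∷ [])

  -- Leaving v towards a proper descendant y of u, the Step 0 arc (p(u), y) bypasses v.
  avoiding-after-v : G v y → y ≢ v → p v ≢ y → PathAvoidingPv y
  avoiding-after-v {y = y} e y≢v pv≢y with y ⊑? p v
  ... | no y⋢pv  = path-outside-pv y⋢pv
  ... | yes y⊑pv = extend-avoiding (path-outside-pv pu⋢pv) bypass pv≢y
    where
    y≢u : y ≢ u
    y≢u refl = pv≢y (⊑-antisym pv⊑u y⊑pv)
    pu⋢pv : ¬ p u ⊑ p v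
    pu⋢pv pu⊑pv = parent-⋢ u≢s (⊑-trans pu⊑pv pv⊑u)
    bypass : G' (p u) y
    bypass = p u , y , inj₂ (refl , e , (⊑-trans y⊑pv pv⊑u , y≢u) , y≢v , pv≢y ∘ sym) ,
             rename-≢ pu≢v , rename-≢ y≢v

  -- v is isolated in G', so a path of G is followed under the invariant
  -- "at v, or reached in G' avoiding p(v)".
  avoiding-step : G x y → p v ≢ y → x ≡ v ⊎ PathAvoidingPv x → y ≡ v ⊎ PathAvoidingPv y
  avoiding-step {x = x} {y = y} e pv≢y reached with y ≟ v
  ... | yes y≡v = inj₁ y≡v
  ... | no y≢v with x ≟ v
  ...   | yes refl = inj₂ (avoiding-after-v e y≢v pv≢y)
  ...   | no x≢v   = inj₂ (extend-avoiding ([ ⊥-elim ∘ x≢v , id ]′ reached)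
                                            (preserved-arc e x≢v y≢v) pv≢y)

  avoiding-along : (q : Path G x y) → All (p v ≢_) (verts q) → y ≢ v →
                   x ≡ v ⊎ PathAvoidingPv x → PathAvoidingPv y
  avoiding-along []      _           y≢v (inj₁ y≡v) = ⊥-elim (y≢v y≡v)
  avoiding-along []      _           _   (inj₂ path) = path
  avoiding-along (e ∷ q) (_ ∷ avoids) y≢v reached =
    avoiding-along q avoids y≢v (avoiding-step e (lookup avoids (first∈ q)) reached)

  Detour : Fin n → Fin n → Set
  Detour x y = Σ (Path G x y) λ q → All (λ z → z ≡ x ⊎ z ≡ y ⊎ z ⊑ u) (verts q)

  loop-to-pv : Σ (Path G v (p v)) λ q → All (_⊑ u) (verts q)
  loop-to-pv = proj₁ (proj₂ v∈loop) ++ₚ proj₁ (treePath pv⊑u) ,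
               All-++ₚ (proj₂ (proj₂ v∈loop)) (All.map proj₂ (proj₂ (treePath pv⊑u)))

  detour-renamed-arc : G x y → Detour (ren x) (ren y)
  detour-renamed-arc {x = x} {y = y} e with x ≟ v | y ≟ v
  ... | yes refl | yes refl = [] , inj₁ refl ∷ []
  ... | yes refl | no _     = treeArc v v≢s ∷ e ∷ [] ,
                               inj₁ refl ∷ inj₂ (inj₂ v⊑u) ∷ inj₂ (inj₁ refl) ∷ []
  ... | no _     | yes refl = e ∷ proj₁ loop-to-pv ,
                               inj₁ refl ∷ All.map (inj₂ ∘ inj₂) (proj₂ loop-to-pv)
  ... | no _     | no _     = e ∷ [] , inj₁ refl ∷ inj₂ (inj₁ refl) ∷ []

  detour-bypass : G v y → Detour (p u) y
  detour-bypass e =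
    treeArc u u≢s ∷ (proj₁ (treePath v⊑u) ++ₚ (e ∷ [])) ,
    inj₁ refl ∷ All-++ₚ (All.map (inj₂ ∘ inj₂ ∘ proj₂) (proj₂ (treePath v⊑u)))
                        (inj₂ (inj₂ v⊑u) ∷ inj₂ (inj₁ refl) ∷ [])

  detour : G' x y → Detour x y
  detour (_ , _ , inj₁ e , refl , refl) = detour-renamed-arc e
  detour (_ , y , inj₂ (refl , e , _ , y≢v , _) , refl , refl) =
    subst₂ Detour (sym (rename-≢ pu≢v)) (sym (rename-≢ y≢v)) (detour-bypass e)

  lift : (q' : Path G' x y) → Σ (Path G x y) λ q → All (λ z → z ∈ verts q' ⊎ z ⊑ u) (verts q)
  lift []                    = [] , inj₁ (here refl) ∷ []
  lift (_∷_ {y = y} e q') =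
    proj₁ (detour e) ++ₚ proj₁ (lift q') ,
    All-++ₚ (All.map on-arc (proj₂ (detour e))) (All.map (map₁ there) (proj₂ (lift q')))
    where
    on-arc : ∀ {z} → z ≡ _ ⊎ z ≡ y ⊎ z ⊑ u → z ∈ verts (e ∷ q') ⊎ z ⊑ u
    on-arc (inj₁ refl)         = inj₁ (here refl)
    on-arc (inj₂ (inj₁ refl))  = inj₁ (there (first∈ q'))
    on-arc (inj₂ (inj₂ z⊑u))   = inj₂ z⊑u

  dominance-preserved : Dom x y → Dom' x y
  dominance-preserved {x = x} {y = y} Dx q' with lookup (proj₂ (lift q')) (Dx (proj₁ (lift q')))
  ... | inj₁ x∈q' = x∈q'
  ... | inj₂ x⊑u with x ≟ y
  ...   | yes refl = last∈ q'
  ...   | no x≢y   = ⊥-elim (dominators-outside y⊑u (below-u-≢s y⊑u) Dx x≢y x⊑u)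
    where
    y⊑u = ⊑-trans (dominator-is-ancestor Dx) x⊑u

  dominance-reflected : y ≢ v → Dom' x y → Dom x y
  dominance-reflected y≢v Dx' q
    with ∈-project⁻ q s≢v y≢v (Dx' (project q s≢v y≢v))
  ... | w , w∈q , x≡ren-w with w ≟ v
  ...   | no _     = subst (_∈ verts q) (sym x≡ren-w) w∈q
  ...   | yes refl with p v ∈? verts q
  ...     | yes pv∈q = subst (_∈ verts q) (sym x≡ren-w) pv∈q
  ...     | no pv∉q  =
    let (q' , avoids) = avoiding-along q (¬Any⇒All¬ _ pv∉q) y≢v (inj₂ (path-outside-pv s⋢pv))
    in ⊥-elim (lookup avoids (Dx' q') (sym x≡ren-w))
    where
    s⋢pv : ¬ s ⊑ p v
    s⋢pv s⊑pv = below-u-≢s (⊑-trans s⊑pv pv⊑u) refl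

  dominance-equivalent : y ≢ v → Dom x y ⇔ Dom' x y
  dominance-equivalent y≢v = mk⇔ dominance-preserved (dominance-reflected y≢v)

lemma10 : (n : ℕ) (A : List (Fin n × Fin n)) (s : Fin n)
    → ((y : Fin n) → Path (arcsOf A) s y)
    → (p : Fin n → Fin n)
    → ((x : Fin n) → x ≢ s → (p x , x) ∈ A)
    → ((x : Fin n) → x ≢ s → toℕ x < toℕ (p x))
    → (u v : Fin n) → u ≢ v
    → InLoop (arcsOf A) p s u v
    → ((x z : Fin n) → Desc p s u x → x ≢ s → IsIdom (arcsOf A) s z x → toℕ u < toℕ z)
    → ((x w : Fin n) → IsIdom (arcsOf A) s x w → x ≢ v)
      × ((x w : Fin n) → w ≢ v
          → (IsIdom (transformArcs (arcsOf A) p s u v) s x w ⇔ IsIdom (arcsOf A) s x w))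
lemma10 n A s _ p treeArc order u v u≢v v∈loop idoms-above =
  (λ _ _ → idom-≢v) , λ _ _ w≢v → isIdom-transfer dominance-equivalent v-dominates-nothing w≢v
  where
  open SpanningTree A s p treeArc order using (dominators-outside-subtree)
  open Transform A s p treeArc order u v u≢v v∈loop (dominators-outside-subtree idoms-above)
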